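{- For every positive integer $k$, every cylindrical grid of order $2k$ contains a 2-horizontal web $(\mathcal{H},\mathcal{V})$ such that $\mathcal{H}$ is minimal with respect to (the union of the paths of) $\mathcal{V}$ and $|\mathcal{H}|=k=|\mathcal{V}|$.
   Context: A cylindrical grid of order $n$: $n$ pairwise disjoint directed cycles $C_1,\dots,C_n$ of length $2n$ and $2n$ pairwise vertex-disjoint directed paths $P_1,\dots,P_{2n}$ of length $n-1$ such that each $P_i$ has exactly one vertex in common with each $C_j$, both endpoints of $P_i$ lie in $V(C_1)\cup V(C_n)$, the paths $P_1,\dots,P_{2n}$ appear on each $C_j$ in this order, and on $P_i$ the cycles appear in order $C_1,\dots,C_n$ for odd $i$ and $C_n,\dots,C_1$ for even $i$. A linkage is a set of pairwise vertex-disjoint directed paths; $|\mathcal{L}|$ is its order. A web $(\mathcal{H},\mathcal{V})$ is a pair of linkages with every path of $\mathcal{V}$ intersecting every path of $\mathcal{H}$. It is 2-horizontal if every $H_i\in\mathcal{H}$ decomposes into consecutive subpaths $H_i=H_i^1\cdot H_i^2$ and every $V_j\in\mathcal{V}$ into $V_j=V_j^1\cdot V_j^2$ (consecutive subpaths sharing their common endpoint) such that $V_j^1\cap H_i\subseteq H_i^1\cup H_i^2$, $V_j^1\cap H_i^2\ne\emptyset$, $V_j^2\cap H_i\subseteq H_i^1$ and $V_j^2\cap H_i^1\ne\emptyset$. A linkage $\mathcal{L}$ of order $k$ is minimal with respect to a subgraph $H$ if for every arc $e$ of $\mathcal{L}$ not in $H$ there is no $\mathrm{Start}(\mathcal{L})$-$\mathrm{End}(\mathcal{L})$-linkage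 of order $k$ in $(\mathcal{L}\cup H)-e$, where $\mathrm{Start},\mathrm{End}$ denote the sets of first/last vertices of the paths. -}

module Defs where

open import Data.Nat using (ℕ; zero; suc; _+_; _<_; _≤_)
open import Data.Nat.DivMod using (_mod_)
open import Data.Fin using (Fin; toℕ)
open import Data.List using (List; []; _∷_; _++_; [_])
open import Data.List.Membership.Propositional using (_∈_)
open import Data.List.Relation.Unary.All using (All)
open import Data.List.Relation.Unary.Unique.Propositional using (Unique)
open import Data.List.Relation.Unary.Linked using (Linked)
open import Data.Product using (Σ; ∃; ∃-syntax; _×_; _,_)
open import Data.Sum using (_⊎_)
open import Data.Empty using (⊥)
open import Relation.Nullary using (¬_)
open import Relation.Binary.PropositionalEquality using (_≡_; _≢_)

-- Digraphs: a vertex type together with an arc relation (simple digraphs,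
-- an arc is identified with the ordered pair of its endpoints).

record Digraph : Set₁ where
  field
    Vx  : Set
    Arc : Vx → Vx → Set

cycNext : ∀ {m} → Fin m → Fin m
cycNext {suc m} i = suc (toℕ i) mod suc m

-- Indices are 0-based: cycle C j (j : Fin n) is C_{j+1} of the paper,
-- path P i (i : Fin (n + n)) is P_{i+1} of the paper.
-- C j s is the s-th vertex of the cycle C_{j+1} (arcs C j s → C j (s+1 mod 2n)),
-- P i t is the t-th vertex of the path P_{i+1} (n vertices, i.e. length n-1).

record CylindricalGrid (G : Digraph) (n : ℕ) : Set where
  open Digraph G
  field
    C : Fin n → Fin (n + n) → Vx
    P : Fin (n + n) → Fin n → Vx
    C-arc : ∀ j s → Arc (C j s) (C j (cycNext s))
    C-inj : ∀ j s s' → C j s ≡ C j s' → s ≡ s'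
    C-disj : ∀ j j' s s' → C j s ≡ C j' s' → j ≡ j'
    P-arc : ∀ i (t t' : Fin n) → toℕ t' ≡ suc (toℕ t) → Arc (P i t) (P i t')
    P-inj : ∀ i t t' → P i t ≡ P i t' → t ≡ t'
    P-disj : ∀ i i' t t' → P i t ≡ P i' t' → i ≡ i'
    P-meets-C : ∀ i j → ∃[ t ] ∃[ s ] (P i t ≡ C j s)
    P-meets-C-once : ∀ i j t t' s s' → P i t ≡ C j s → P i t' ≡ C j s' → t ≡ t'
    P-endpoints : ∀ i (t : Fin n) → (toℕ t ≡ 0 ⊎ suc (toℕ t) ≡ n) →
      ∃[ j ] ∃[ s ] ((toℕ j ≡ 0 ⊎ suc (toℕ j) ≡ n) × P i t ≡ C j s)
    C-order : ∀ j (i i' : Fin (n + n)) t t' s s' → toℕ i' ≡ suc (toℕ i) →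
      P i t ≡ C j s → P i' t' ≡ C j s' → s' ≡ cycNext s
    -- on P_i the cycles appear in order C_1,...,C_n for odd i (paper indexing),
    -- i.e. toℕ i even here, and in order C_n,...,C_1 for even i
    P-order-odd : ∀ i → (∃[ m ] (toℕ i ≡ m + m)) → ∀ j j' t t' s s' →
      P i t ≡ C j s → P i t' ≡ C j' s' → toℕ j < toℕ j' → toℕ t < toℕ t'
    P-order-even : ∀ i → (∃[ m ] (toℕ i ≡ suc (m + m))) → ∀ j j' t t' s s' →
      P i t ≡ C j s → P i t' ≡ C j' s' → toℕ j < toℕ j' → toℕ t' < toℕ t

module _ {G : Digraph} {n : ℕ} (Γ : CylindricalGrid G n) where
  open Digraph G
  open CylindricalGrid Γ

  GridArc : Vx → Vx → Set
  GridArc u v = (∃[ j ] ∃[ s ] (u ≡ C j s × v ≡ C j (cycNext s)))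
              ⊎ (∃[ i ] ∃[ t ] ∃[ t' ] (toℕ t' ≡ suc (toℕ t) × u ≡ P i t × v ≡ P i t'))

  GridVertex : Vx → Set
  GridVertex v = (∃[ j ] ∃[ s ] (v ≡ C j s)) ⊎ (∃[ i ] ∃[ t ] (v ≡ P i t))

module _ {V : Set} where

  IsPath : (V → Set) → (V → V → Set) → List V → Set
  IsPath Vert A p = (p ≢ []) × Unique p × Linked A p × All Vert p

  Disjoint : List V → List V → Set
  Disjoint p q = ∀ v → v ∈ p → v ∈ q → ⊥

  IsLinkage : (V → Set) → (V → V → Set) → (k : ℕ) → (Fin k → List V) → Set
  IsLinkage Vert A k L = (∀ i → IsPath Vert A (L i)) × (∀ i j → i ≢ j → Disjoint (L i) (L j))

  ArcOf : List V → V → V → Set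
  ArcOf p u v = ∃[ pre ] ∃[ suf ] (p ≡ pre ++ u ∷ v ∷ suf)

  IsStart IsEnd : V → List V → Set
  IsStart v p = ∃[ suf ] (p ≡ v ∷ suf)
  IsEnd   v p = ∃[ pre ] (p ≡ pre ++ [ v ])

  LArc : ∀ {k} → (Fin k → List V) → V → V → Set
  LArc L u v = ∃[ i ] ArcOf (L i) u v

  LVertex : ∀ {k} → (Fin k → List V) → V → Set
  LVertex L v = ∃[ i ] (v ∈ L i)

  Start End : ∀ {k} → (Fin k → List V) → V → Set
  Start L v = ∃[ i ] IsStart v (L i)
  End   L v = ∃[ i ] IsEnd v (L i)

  IsWeb : ∀ {k l} → (Fin k → List V) → (Fin l → List V) → Set
  IsWeb H W = ∀ i j → ∃[ v ] (v ∈ H i × v ∈ W j)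

  Split : List V → List V → List V → Set
  Split p a b = ∃[ pre ] ∃[ x ] ∃[ suf ]
    (p ≡ pre ++ x ∷ suf × a ≡ pre ++ [ x ] × b ≡ x ∷ suf)

  Meets : List V → List V → Set
  Meets p q = ∃[ v ] (v ∈ p × v ∈ q)

  TwoHorizontal : ∀ {k l} → (Fin k → List V) → (Fin l → List V) → Set
  TwoHorizontal {k} {l} H W =
    Σ (Fin k → List V) λ H¹ → Σ (Fin k → List V) λ H² →
    Σ (Fin l → List V) λ W¹ → Σ (Fin l → List V) λ W² →
      ( (∀ i → Split (H i) (H¹ i) (H² i))
      × (∀ j → Split (W j) (W¹ j) (W² j))
      × (∀ i j →
           (∀ v → v ∈ W¹ j → v ∈ H i → v ∈ H¹ i ⊎ v ∈ H² i)
         × Meets (W¹ j) (H² i)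
         × (∀ v → v ∈ W² j → v ∈ H i → v ∈ H¹ i)
         × Meets (W² j) (H¹ i)) )

  MinimalWrt : ∀ {k l} → (Fin k → List V) → (Fin l → List V) → Set
  MinimalWrt {k} L W =
    ∀ a b → LArc L a b → ¬ LArc W a b →
      ¬ (Σ (Fin k → List V) λ Q →
                  ( IsLinkage
                    (λ v → LVertex L v ⊎ LVertex W v)
                    (λ u v → (LArc L u v ⊎ LArc W u v) × ¬ (u ≡ a × v ≡ b))
                    k Q
                × (∀ i → ∃[ v ] (IsStart v (Q i) × Start L v))
                × (∀ i → ∃[ v ] (IsEnd v (Q i) × End L v))))

{-# OPTIONS --safe #-}
-- Index the grid of order n = 2k by (r , p), the vertex of the cycle C_{r+1} on the path P_{p+1}:
-- rows are cycles through all 2n columns, even columns run upwards and odd columns downwards.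
-- For i < k the path H_i climbs the even column a_i = n + 2i up to row top_i = n - 1 - i, follows
-- that row to the right through the wrap-around from column 2n - 1 to column 0 until the odd
-- column b_i = 2(k - 1 - i) + 1 < n, and descends column b_i to row 0; W_j (j < k) is row j cut
-- open between columns 2n - 1 and 0. H_i meets W_j at (j , a_i) and (j , b_i), and cutting W_j at
-- column n and H_i at (top_i , b_i) makes the web 2-horizontal, since the right half of W_j lies
-- in the columns ≥ n while the descent of H_i lies in column b_i < n.
--
-- For minimality, take a Start(H)-End(H) linkage of order k in H ∪ W. Each of its paths gets from
-- a column ≥ n to a column < n, which only the k wrap-around arcs of the H_i allow, and crosses
-- every row j < k upwards and downwards, which only the k arcs (j , a_i) → (j + 1 , a_i), resp.
-- (j + 1 , b_i) → (j , b_i), allow. The paths being disjoint, every arc of each of these cuts is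
-- used. Above row k, on the other hand, the only arcs of H ∪ W at a vertex of H_i are those of
-- H_i, so the path through the wrap-around arc of H_i is forced along H_i there. Hence the linkage
-- uses every arc of H and cannot avoid a removed one.
module Submission where

open import Defs hiding (Disjoint)
open import Data.Nat using (ℕ; zero; suc; pred; _+_; _∸_; _≤_; _<_; z≤n; s≤s; z<s; _≤?_; _<?_; NonZero)
open import Data.Nat.Properties
open import Data.Nat.DivMod using (_%_; _mod_; %-distribˡ-+; m%n%n≡m%n; [m+n]%n≡m%n; m<n⇒m%n≡m)
open import Data.Nat.Tactic.RingSolver using (solve-∀)
open import Data.Fin using (Fin; toℕ; punchOut)
open import Data.Fin.Patterns using (0F)
open import Data.Fin.Properties
  using (toℕ-injective; toℕ<n; toℕ-fromℕ<; any?; punchOut-injective; injective⇒≤) renaming (_≟_ to _≟ᶠ_)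
open import Data.List using (List; []; _∷_; _++_; [_]; map; applyUpTo; applyDownFrom; initLast; _∷ʳ′_)
open import Data.List.Properties
  using (++-assoc; ++-conicalʳ; map-++; ∷-injective; ∷ʳ-injectiveʳ; applyDownFrom-∷ʳ)
open import Data.List.Membership.Propositional using (_∈_)
open import Data.List.Membership.Propositional.Properties
  using ( ∈-++⁻; ∈-++⁺ˡ; ∈-++⁺ʳ; ∈-map⁺; ∈-map⁻
        ; ∈-applyUpTo⁺; ∈-applyUpTo⁻; ∈-applyDownFrom⁺; ∈-applyDownFrom⁻)
open import Data.List.Relation.Binary.Disjoint.Propositional using (Disjoint)
open import Data.List.Relation.Unary.Any using (here; there)
open import Data.List.Relation.Unary.All using (All; []; _∷_)
import Data.List.Relation.Unary.All as All
import Data.List.Relation.Unary.All.Properties as Allₚ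
open import Data.List.Relation.Unary.Linked using (Linked; _∷_)
import Data.List.Relation.Unary.Linked as Linked
import Data.List.Relation.Unary.Linked.Properties as Linkedₚ
open import Data.List.Relation.Unary.Unique.Propositional using (Unique)
import Data.List.Relation.Unary.Unique.Propositional.Properties as Uniqueₚ
open import Data.List.Relation.Unary.AllPairs using ([]; _∷_)
open import Data.Product using (∃; ∃₂; ∃-syntax; _×_; _,_; proj₁; proj₂)
open import Data.Sum using (_⊎_; inj₁; inj₂)
open import Data.Empty using (⊥; ⊥-elim)
open import Function using (_∘_)
open import Relation.Nullary using (¬_; yes; no; contradiction)
open import Relation.Unary using (Decidable)
open import Relation.Binary using (tri<; tri≈; tri>)
open import Relation.Binary.PropositionalEquality hiding ([_])

-- Paths as vertex lists

module _ {A : Set} where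

  arcOf-∷ : ∀ {z : A} {l u v} → ArcOf l u v → ArcOf (z ∷ l) u v
  arcOf-∷ {z} (pre , suf , refl) = z ∷ pre , suf , refl

  arcOf⇒∈ : ∀ {l} {u v : A} → ArcOf l u v → u ∈ l × v ∈ l
  arcOf⇒∈ (pre , suf , refl) = ∈-++⁺ʳ pre (here refl) , ∈-++⁺ʳ pre (there (here refl))

  arcOf-linked : ∀ {R : A → A → Set} {l u v} → Linked R l → ArcOf l u v → R u v
  arcOf-linked {R} {u = u} {v} linked (pre , suf , refl) = go pre linked
    where
    go : ∀ pre → Linked R (pre ++ u ∷ v ∷ suf) → R u v
    go []        linked = Linked.head linked
    go (_ ∷ pre) linked = go pre (Linked.tail linked)

  linked-applyUpTo-++ : ∀ {R : A → A → Set} f m {y ys} → (∀ {t} → t < m → R (f t) (f (suc t))) →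
                        R (f m) y → Linked R (y ∷ ys) → Linked R (applyUpTo f (suc m) ++ y ∷ ys)
  linked-applyUpTo-++ f zero    _     last rest = last ∷ rest
  linked-applyUpTo-++ f (suc m) steps last rest =
    steps z<s ∷ linked-applyUpTo-++ (λ t → f (suc t)) m (λ t<m → steps (s≤s t<m)) last rest

  isStart⇒∈ : ∀ {x : A} {l} → IsStart x l → x ∈ l
  isStart⇒∈ (_ , refl) = here refl

  isEnd⇒∈ : ∀ {x : A} {l} → IsEnd x l → x ∈ l
  isEnd⇒∈ (pre , refl) = ∈-++⁺ʳ pre (here refl)

  isEnd-++ : ∀ {x : A} xs {l} → IsEnd x l → IsEnd x (xs ++ l)
  isEnd-++ xs (pre , refl) = xs ++ pre , sym (++-assoc xs pre _)

  isEnd-unique : ∀ {x y : A} {l} → IsEnd x l → IsEnd y l → x ≡ y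
  isEnd-unique (pre , refl) (pre' , e) = ∷ʳ-injectiveʳ pre pre' e

  module _ {P : A → Set} (P? : Decidable P) where

    exit-arc : ∀ {x y l} → IsStart x l → P x → y ∈ l → ¬ P y →
               ∃₂ λ u v → ArcOf l u v × P u × ¬ P v
    exit-arc (_ , refl) px (here refl) ¬py = contradiction px ¬py
    exit-arc {x} (x' ∷ suf , refl) px (there y∈) ¬py with P? x'
    ... | no ¬px' = x , x' , ([] , suf , refl) , px , ¬px'
    ... | yes px' with u , v , arc , pu , ¬pv ← exit-arc (suf , refl) px' y∈ ¬py =
      u , v , arcOf-∷ arc , pu , ¬pv

    exit-arc-before-end : ∀ {y z l} → IsEnd z l → y ∈ l → P y → ¬ P z →
                          ∃₂ λ u v → ArcOf l u v × P u × ¬ P v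
    exit-arc-before-end ([] , refl) (here refl) py ¬pz = contradiction py ¬pz
    exit-arc-before-end (_ ∷ pre , refl) (here refl) py ¬pz =
      exit-arc (pre ++ _ , refl) py (there (∈-++⁺ʳ pre (here refl))) ¬pz
    exit-arc-before-end (_ ∷ pre , refl) (there y∈) py ¬pz
      with u , v , arc , pu , ¬pv ← exit-arc-before-end (pre , refl) y∈ py ¬pz =
      u , v , arcOf-∷ arc , pu , ¬pv

  predecessor : ∀ {x y : A} {l} → IsStart x l → y ∈ l → y ≢ x → ∃[ z ] ArcOf l z y
  predecessor (_ , refl) (here refl) y≢x = contradiction refl y≢x
  predecessor (suf , refl) (there y∈) _ = go suf y∈
    where
    go : ∀ {x y} suf → y ∈ suf → ∃[ z ] ArcOf (x ∷ suf) z y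
    go {x} (_ ∷ suf) (here refl) = x , [] , suf , refl
    go (s ∷ suf) (there y∈) with z , arc ← go {s} suf y∈ = z , arcOf-∷ arc

  successor : ∀ {x y : A} {l} → IsEnd x l → y ∈ l → y ≢ x → ∃[ z ] ArcOf l y z
  successor (pre , refl) y∈ y≢x with ∈-++⁻ pre y∈
  ... | inj₂ (here y≡x) = contradiction y≡x y≢x
  ... | inj₁ y∈pre = go pre y∈pre
    where
    go : ∀ {x y} pre → y ∈ pre → ∃[ z ] ArcOf (pre ++ [ x ]) y z
    go {x} (_ ∷ []) (here refl) = x , [] , [] , refl
    go (_ ∷ q ∷ pre) (here refl) = q , [] , pre ++ _ , refl
    go (_ ∷ pre) (there y∈) with z , arc ← go pre y∈ = z , arcOf-∷ arc

module _ {A B : Set} (f : A → B) where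

  arcOf-map⁺ : ∀ {l u v} → ArcOf l u v → ArcOf (map f l) (f u) (f v)
  arcOf-map⁺ (pre , suf , refl) = map f pre , map f suf , map-++ f pre _

  arcOf-map⁻ : ∀ {l u v} → ArcOf (map f l) u v → ∃₂ λ x y → ArcOf l x y × f x ≡ u × f y ≡ v
  arcOf-map⁻ {x ∷ y ∷ l} ([] , suf , e) with fx≡u , e′ ← ∷-injective e =
    x , y , ([] , l , refl) , fx≡u , proj₁ (∷-injective e′)
  arcOf-map⁻ {x ∷ l} (_ ∷ pre , suf , e)
    with x′ , y′ , arc , e₁ , e₂ ← arcOf-map⁻ (pre , suf , proj₂ (∷-injective e)) =
    x′ , y′ , arcOf-∷ arc , e₁ , e₂

  isStart-map⁻ : ∀ {l y} → IsStart y (map f l) → ∃[ x ] (IsStart x l × f x ≡ y)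
  isStart-map⁻ {x ∷ l} (_ , e) = x , (l , refl) , proj₁ (∷-injective e)

  module _ {P : A → Set} (injective : ∀ {x y} → P x → P y → f x ≡ f y → x ≡ y) where

    injective-arcOf-map⁻ : ∀ {l x y} → All P l → P x → P y → ArcOf (map f l) (f x) (f y) → ArcOf l x y
    injective-arcOf-map⁻ pl px py arc with x′ , y′ , arc′ , e₁ , e₂ ← arcOf-map⁻ arc
      with refl ← injective (All.lookup pl (proj₁ (arcOf⇒∈ arc′))) px e₁
         | refl ← injective (All.lookup pl (proj₂ (arcOf⇒∈ arc′))) py e₂ = arc′

    unique-map : ∀ {l} → All P l → Unique l → Unique (map f l)
    unique-map [] [] = []
    unique-map (px ∷ pl) (x∉ ∷ u) =
      Allₚ.map⁺ (All.zipWith (λ (x≢y , py) fx≡fy → x≢y (injective px py fx≡fy)) (x∉ , pl)) ∷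
      unique-map pl u

  map-preimage : ∀ {P : A → Set} {ys} → All (λ y → ∃[ x ] (P x × f x ≡ y)) ys →
                 ∃[ xs ] (All P xs × map f xs ≡ ys)
  map-preimage [] = [] , [] , refl
  map-preimage ((x , px , refl) ∷ all) with xs , pxs , refl ← map-preimage all = x ∷ xs , px ∷ pxs , refl

  isEnd-map⁻ : ∀ {l y} → IsEnd y (map f l) → ∃[ x ] (IsEnd x l × f x ≡ y)
  isEnd-map⁻ {l} (pre , e) with initLast l
  ... | []       = contradiction (++-conicalʳ pre _ (sym e)) λ ()
  ... | xs ∷ʳ′ x = x , (xs , refl) , ∷ʳ-injectiveʳ (map f xs) pre (trans (sym (map-++ f xs [ x ])) e)

total-injective⇒surjective : ∀ {k} {U : Fin k → Fin k → Set} → (∀ m → ∃ (U m)) →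
                             (∀ {m m' i} → U m i → U m' i → m ≡ m') → ∀ i → ∃[ m ] U m i
total-injective⇒surjective {suc k} {U} choose injective i with any? (λ m → proj₁ (choose m) ≟ᶠ i)
... | yes (m , refl) = m , proj₂ (choose m)
... | no no-hit = contradiction (injective⇒≤ g-injective) 1+n≰n
  where
  g : Fin (suc k) → Fin k
  g m = punchOut {i = i} (λ e → no-hit (m , sym e))
  g-injective : ∀ {m m'} → g m ≡ g m' → m ≡ m'
  g-injective {m} {m'} e =
    injective (proj₂ (choose m)) (subst (U m') (sym (punchOut-injective {i = i} _ _ e)) (proj₂ (choose m')))

downward-induction : ∀ {P : ℕ → Set} {m} → P m → (∀ {p} → p < m → P (suc p) → P p) →
                     ∀ {p} → p ≤ m → P p
downward-induction {P} {m} Pm step {p} p≤m = go (m ∸ p) (m∸n+n≡m p≤m)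
  where
  go : ∀ d {p} → d + p ≡ m → P p
  go zero    refl = Pm
  go (suc d) {p} e = step (subst (p <_) e (s≤s (m≤n+m p d))) (go d (trans (+-suc d p) e))

increasing⇒id : ∀ {n} {g : ℕ → ℕ} → (∀ {r} → r < n → g r < n) →
                (∀ {r r'} → r < r' → r' < n → g r < g r') → ∀ {r} → r < n → g r ≡ r
increasing⇒id {n} {g} bounded increasing {r} r<n = ≤-antisym upper (lower r r<n)
  where
  lower : ∀ r → r < n → r ≤ g r
  lower zero    _ = z≤n
  lower (suc r) h = ≤-<-trans (lower r (<-trans (n<1+n r) h)) (increasing (n<1+n r) h)
  spread : ∀ d {r} → d + r < n → d + g r ≤ g (d + r)
  spread zero    _ = ≤-refl
  spread (suc d) h = ≤-<-trans (spread d (<-trans (n<1+n _) h)) (increasing (n<1+n _) h)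
  d : ℕ
  d = n ∸ suc r
  1+d+r≡n : suc (d + r) ≡ n
  1+d+r≡n = trans (sym (+-suc d r)) (m∸n+n≡m r<n)
  d+r<n : d + r < n
  d+r<n = subst (d + r <_) 1+d+r≡n (n<1+n (d + r))
  upper : g r ≤ r
  upper = +-cancelˡ-≤ d (g r) r
            (≤-pred (≤-<-trans (spread d d+r<n) (subst (g (d + r) <_) (sym 1+d+r≡n) (bounded d+r<n))))

decreasing⇒reflection : ∀ {n} {g : ℕ → ℕ} → (∀ {r} → r < n → g r < n) →
                        (∀ {r r'} → r < r' → r' < n → g r' < g r) → ∀ {r} → r < n → suc (g r + r) ≡ n
decreasing⇒reflection {n} {g} bounded decreasing {r} r<n =
  subst (λ x → suc (g r + x) ≡ n) (increasing⇒id h-bounded h-increasing r<n) (m+[n∸m]≡n (bounded r<n))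
  where
  h : ℕ → ℕ
  h r = n ∸ suc (g r)
  h-bounded : ∀ {r} → r < n → h r < n
  h-bounded r<n = ∸-monoʳ-< z<s (bounded r<n)
  h-increasing : ∀ {r r'} → r < r' → r' < n → h r < h r'
  h-increasing r<r' r'<n = ∸-monoʳ-< (s≤s (decreasing r<r' r'<n)) (bounded (<-trans r<r' r'<n))

-- Coordinates on a cylindrical grid

Coord : Set
Coord = ℕ × ℕ

row col : Coord → ℕ
row = proj₁
col = proj₂

Inside : ℕ → Coord → Set
Inside n (r , p) = r < n × p < n + n

record CylinderCoordinates (V : Set) (Arc : V → V → Set) (Vertex : V → Set) (n : ℕ) : Set where
  field
    vx           : Coord → V
    vx-injective : ∀ {c c'} → Inside n c → Inside n c' → vx c ≡ vx c' → c ≡ c'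
    vx-vertex    : ∀ c → Vertex (vx c)
    right-arc    : ∀ r p → Arc (vx (r , p)) (vx (r , suc p))
    wrap-arc     : ∀ r → Arc (vx (r , pred (n + n))) (vx (r , 0))
    up-arc       : ∀ {r q} → suc r < n → q + q < n + n → Arc (vx (r , q + q)) (vx (suc r , q + q))
    down-arc     : ∀ {r q} → suc r < n → suc (q + q) < n + n →
                   Arc (vx (suc r , suc (q + q))) (vx (r , suc (q + q)))

toℕ-mod : ∀ {m n} .{{_ : NonZero n}} → m < n → toℕ (m mod n) ≡ m
toℕ-mod m<n = trans (toℕ-fromℕ< _) (m<n⇒m%n≡m m<n)

module _ {G : Digraph} {m : ℕ} (Γ : CylindricalGrid G (suc m)) where
  open Digraph G
  open CylindricalGrid Γ

  private
    n N : ℕ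
    n = suc m
    N = n + n

  steps : ℕ → Fin N → Fin N
  steps zero    s = s
  steps (suc p) s = cycNext (steps p s)

  toℕ-steps : ∀ p s → toℕ (steps p s) ≡ (toℕ s + p) % N
  toℕ-steps zero    s = sym (trans (cong (_% N) (+-identityʳ (toℕ s))) (m<n⇒m%n≡m (toℕ<n s)))
  toℕ-steps (suc p) s = begin
    toℕ (cycNext (steps p s))        ≡⟨ toℕ-fromℕ< _ ⟩
    suc (toℕ (steps p s)) % N        ≡⟨ cong (λ x → suc x % N) (toℕ-steps p s) ⟩
    (1 + (toℕ s + p) % N) % N        ≡⟨ %-distribˡ-+ 1 ((toℕ s + p) % N) N ⟩
    (1 % N + (toℕ s + p) % N % N) % N ≡⟨ cong (λ x → (1 % N + x) % N) (m%n%n≡m%n (toℕ s + p) N) ⟩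
    (1 % N + (toℕ s + p) % N) % N    ≡⟨ %-distribˡ-+ 1 (toℕ s + p) N ⟨
    suc (toℕ s + p) % N              ≡⟨ cong (_% N) (+-suc (toℕ s) p) ⟨
    (toℕ s + suc p) % N              ∎
    where open ≡-Reasoning

  steps-period : ∀ s → steps N s ≡ s
  steps-period s =
    toℕ-injective (trans (toℕ-steps N s) (trans ([m+n]%n≡m%n (toℕ s) N) (m<n⇒m%n≡m (toℕ<n s))))

  origin : ℕ → Fin N
  origin r = proj₁ (proj₂ (P-meets-C 0F (r mod n)))

  -- Walking p steps along C_{r+1} from its vertex on P_1 reaches its vertex on P_{p+1} (onColumn,
  -- by C-order); after 2n steps the walk is back, which gives the wrap-around arcs.
  vertexAt : Coord → Vx
  vertexAt (r , p) = C (r mod n) (steps p (origin r))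

  onColumn : ∀ r {p} → p < N → ∃[ t ] (P (p mod N) t ≡ vertexAt (r , p))
  onColumn r {zero} _ = proj₁ (P-meets-C 0F (r mod n)) , proj₂ (proj₂ (P-meets-C 0F (r mod n)))
  onColumn r {suc p} p<N with t , Pt≡ ← onColumn r (<-trans (n<1+n p) p<N)
                         with t' , s' , Pt'≡ ← P-meets-C (suc p mod N) (r mod n) =
    t' , trans Pt'≡ (cong (C (r mod n)) (C-order _ (p mod N) (suc p mod N) t t' _ s' consecutive Pt≡ Pt'≡))
    where
    consecutive : toℕ (suc p mod N) ≡ suc (toℕ (p mod N))
    consecutive = trans (toℕ-mod p<N) (cong suc (sym (toℕ-mod (<-trans (n<1+n p) p<N))))

  vertexAt-injective : ∀ {c c'} → Inside n c → Inside n c' → vertexAt c ≡ vertexAt c' → c ≡ c'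
  vertexAt-injective {r , p} {r' , p'} (r<n , p<N) (r'<n , p'<N) e = cong₂ _,_ same-row same-col
    where
    same-row : r ≡ r'
    same-row = trans (sym (toℕ-mod r<n)) (trans (cong toℕ (C-disj _ _ _ _ e)) (toℕ-mod r'<n))
    same-col : p ≡ p'
    same-col with t , et ← onColumn r p<N | t' , et' ← onColumn r' p'<N =
      trans (sym (toℕ-mod p<N))
            (trans (cong toℕ (P-disj _ _ t t' (trans et (trans e (sym et'))))) (toℕ-mod p'<N))

  height : ∀ {p} → p < N → ℕ → ℕ
  height p<N r = toℕ (proj₁ (onColumn r p<N))

  column-arc : ∀ {p} (p<N : p < N) {r r'} → height p<N r' ≡ suc (height p<N r) →
               GridArc Γ (vertexAt (r , p)) (vertexAt (r' , p))
  column-arc {p} p<N {r} {r'} e =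
    inj₂ (p mod N , _ , _ , e , sym (proj₂ (onColumn r p<N)) , sym (proj₂ (onColumn r' p<N)))

  rows-ordered : ∀ {r r'} → r < r' → r' < n → toℕ (r mod n) < toℕ (r' mod n)
  rows-ordered r<r' r'<n = subst₂ _<_ (sym (toℕ-mod (<-trans r<r' r'<n))) (sym (toℕ-mod r'<n)) r<r'

  grid-up-arc : ∀ {r q} → suc r < n → q + q < N →
                GridArc Γ (vertexAt (r , q + q)) (vertexAt (suc r , q + q))
  grid-up-arc {r} {q} r+1<n q+q<N =
    column-arc q+q<N {r} {suc r} (trans (height≡ r+1<n) (cong suc (sym (height≡ (<-trans (n<1+n r) r+1<n)))))
    where
    increasing : ∀ {r r'} → r < r' → r' < n → height q+q<N r < height q+q<N r'
    increasing {r} {r'} r<r' r'<n =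
      P-order-odd _ (q , toℕ-mod q+q<N) _ _ _ _ _ _
        (proj₂ (onColumn r q+q<N)) (proj₂ (onColumn r' q+q<N)) (rows-ordered r<r' r'<n)
    height≡ : ∀ {r} → r < n → height q+q<N r ≡ r
    height≡ = increasing⇒id (λ _ → toℕ<n _) increasing

  grid-down-arc : ∀ {r q} → suc r < n → suc (q + q) < N →
                  GridArc Γ (vertexAt (suc r , suc (q + q))) (vertexAt (r , suc (q + q)))
  grid-down-arc {r} {q} r+1<n q<N = column-arc q<N {suc r} {r}
    (+-cancelʳ-≡ r _ _ (suc-injective (trans (reflection (<-trans (n<1+n r) r+1<n))
                                              (trans (sym (reflection r+1<n)) (cong suc (+-suc _ r))))))
    where
    decreasing : ∀ {r r'} → r < r' → r' < n → height q<N r' < height q<N r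
    decreasing {r} {r'} r<r' r'<n =
      P-order-even _ (q , toℕ-mod q<N) _ _ _ _ _ _
        (proj₂ (onColumn r q<N)) (proj₂ (onColumn r' q<N)) (rows-ordered r<r' r'<n)
    reflection : ∀ {r} → r < n → suc (height q<N r + r) ≡ n
    reflection = decreasing⇒reflection (λ _ → toℕ<n _) decreasing

  coordinates : CylinderCoordinates Vx (GridArc Γ) (GridVertex Γ) n
  coordinates = record
    { vx           = vertexAt
    ; vx-injective = vertexAt-injective
    ; vx-vertex    = λ (r , p) → inj₁ (r mod n , steps p (origin r) , refl)
    ; right-arc    = λ r p → inj₁ (r mod n , steps p (origin r) , refl , refl)
    ; wrap-arc     = λ r → inj₁ (r mod n , _ , refl , cong (C (r mod n)) (sym (steps-period (origin r))))
    ; up-arc       = λ {r} {q} → grid-up-arc {r} {q}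
    ; down-arc     = λ {r} {q} → grid-down-arc {r} {q}
    }

-- The web

module Construction {V : Set} {Arc : V → V → Set} {Vertex : V → Set} (K : ℕ)
                    (cyl : CylinderCoordinates V Arc Vertex (suc K + suc K)) where
  open CylinderCoordinates cyl

  k n N N' : ℕ
  k  = suc K
  n  = k + k
  N  = n + n
  N' = pred N

  w : Fin k → ℕ
  w i = K ∸ toℕ i

  a b top : Fin k → ℕ
  a i   = (toℕ i + toℕ i) + n
  b i   = suc (w i + w i)
  top i = k + w i

  w≤K : ∀ i → w i ≤ K
  w≤K i = m∸n≤m K (toℕ i)

  b<n : ∀ i → b i < n
  b<n i = s≤s (+-mono-≤-< (w≤K i) (s≤s (w≤K i)))

  n≤a : ∀ i → n ≤ a i
  n≤a i = m≤n+m n _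

  b<a : ∀ i → b i < a i
  b<a i = <-≤-trans (b<n i) (n≤a i)

  k≤top : ∀ i → k ≤ top i
  k≤top i = m≤m+n k (w i)

  top<n : ∀ i → top i < n
  top<n i = +-monoʳ-< k (s≤s (w≤K i))

  a+b≡N' : ∀ i → (w i + w i) + suc (a i) ≡ N'
  a+b≡N' i =
    subst (λ K → (w i + w i) + suc ((toℕ i + toℕ i) + (suc K + suc K)) ≡ (K + suc K) + (suc K + suc K))
          (m+[n∸m]≡n (≤-pred (toℕ<n i))) (identity (toℕ i) (w i))
    where
    identity : ∀ u v → (v + v) + suc ((u + u) + (suc (u + v) + suc (u + v))) ≡
                       ((u + v) + suc (u + v)) + (suc (u + v) + suc (u + v))
    identity = solve-∀

  a<N' : ∀ i → a i < N'
  a<N' i = subst (a i <_) (a+b≡N' i) (m≤n+m (suc (a i)) _)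

  b<N' : ∀ i → b i < N'
  b<N' i = <-trans (b<a i) (a<N' i)

  module _ {i i' : Fin k} (i<i' : toℕ i < toℕ i') where
    w-decreasing : w i' < w i
    w-decreasing = ∸-monoʳ-< i<i' (≤-pred (toℕ<n i'))

    a-increasing : a i < a i'
    a-increasing = +-monoˡ-< n (+-mono-< i<i' i<i')

    b-decreasing : b i' < b i
    b-decreasing = s≤s (+-mono-< w-decreasing w-decreasing)

    top-decreasing : top i' < top i
    top-decreasing = +-monoʳ-< k w-decreasing

  data OnH (a b top : ℕ) : Coord → Set where
    on-ascent  : ∀ {r} → r ≤ top → OnH a b top (r , a)
    on-descent : ∀ {r} → r ≤ top → OnH a b top (r , b)
    on-right   : ∀ {p} → a < p → p < N → OnH a b top (top , p)
    on-left    : ∀ {p} → p < b → OnH a b top (top , p)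

  data HArc (a b top : ℕ) : Coord → Coord → Set where
    up           : ∀ {r} → r < top → HArc a b top (r , a) (suc r , a)
    right-from-a : ∀ {p} → a ≤ p → p < N' → HArc a b top (top , p) (top , suc p)
    wrap         : HArc a b top (top , N') (top , 0)
    right-to-b   : ∀ {p} → p < b → HArc a b top (top , p) (top , suc p)
    down         : ∀ {r} → r < top → HArc a b top (suc r , b) (r , b)

  data RightArc : Coord → Coord → Set where
    right : ∀ {r p} → RightArc (r , p) (r , suc p)

  OnHᵢ : Fin k → Coord → Set
  OnHᵢ i = OnH (a i) (b i) (top i)

  HArcᵢ : Fin k → Coord → Coord → Set
  HArcᵢ i = HArc (a i) (b i) (top i)

  ascent toLastColumn fromFirstColumn descent H : Fin k → List Coord
  ascent i          = applyUpTo (λ r → (r , a i)) (suc (top i))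
  toLastColumn i    = applyUpTo (λ t → (top i , t + suc (a i))) (b i)
  fromFirstColumn i = applyUpTo (λ p → (top i , p)) (b i)
  descent i         = applyDownFrom (λ r → (r , b i)) (suc (top i))
  H i = ascent i ++ toLastColumn i ++ fromFirstColumn i ++ descent i

  leftHalf rightHalf W : Fin k → List Coord
  leftHalf j  = applyUpTo (λ p → (toℕ j , p)) n
  rightHalf j = applyUpTo (λ t → (toℕ j , t + n)) n
  W j = leftHalf j ++ rightHalf j

  H-linked : ∀ i → Linked (HArcᵢ i) (H i)
  H-linked i =
    linked-applyUpTo-++ (λ r → (r , a i)) (top i) up (right-from-a ≤-refl (a<N' i))
      (linked-applyUpTo-++ (λ t → (top i , t + suc (a i))) (w i + w i) right-of-a
                           (subst (λ p → HArcᵢ i (top i , p) (top i , 0)) (sym (a+b≡N' i)) wrap)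
        (linked-applyUpTo-++ (λ p → (top i , p)) (w i + w i) (λ t<2w → right-to-b (m<n⇒m<1+n t<2w))
                             (right-to-b (n<1+n _))
          (Linkedₚ.applyDownFrom⁺₁ (λ r → (r , b i)) (suc (top i)) (λ r+1<t+1 → down (≤-pred r+1<t+1)))))
    where
    right-of-a : ∀ {t} → t < w i + w i → HArcᵢ i (top i , t + suc (a i)) (top i , suc (t + suc (a i)))
    right-of-a {t} t<2w = right-from-a (≤-trans (n≤1+n (a i)) (m≤n+m (suc (a i)) t))
                                       (subst (t + suc (a i) <_) (a+b≡N' i) (+-monoˡ-< (suc (a i)) t<2w))

  W-linked : ∀ j → Linked RightArc (W j)
  W-linked j = linked-applyUpTo-++ (λ p → (toℕ j , p)) (K + k) (λ _ → right) right
                 (Linkedₚ.applyUpTo⁺₂ (λ t → (toℕ j , t + n)) n (λ _ → right))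

  OnH-row : ∀ {a b top c} → OnH a b top c → row c ≤ top
  OnH-row (on-ascent r≤top)  = r≤top
  OnH-row (on-descent r≤top) = r≤top
  OnH-row (on-right _ _)     = ≤-refl
  OnH-row (on-left _)        = ≤-refl

  OnH-outside : ∀ {a b top c} → OnH a b top c → a ≤ col c ⊎ col c ≤ b
  OnH-outside (on-ascent _)    = inj₁ ≤-refl
  OnH-outside (on-descent _)   = inj₂ ≤-refl
  OnH-outside (on-right a<p _) = inj₁ (<⇒≤ a<p)
  OnH-outside (on-left p<b)    = inj₂ (<⇒≤ p<b)

  OnH-between : ∀ {a b top c} → b ≤ a → OnH a b top c → row c < top → b ≤ col c × col c ≤ a
  OnH-between b≤a (on-ascent _)  _ = b≤a , ≤-refl
  OnH-between b≤a (on-descent _) _ = ≤-refl , b≤a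
  OnH-between _   (on-right _ _) top<top = ⊥-elim (<-irrefl refl top<top)
  OnH-between _   (on-left _)    top<top = ⊥-elim (<-irrefl refl top<top)

  OnH-separated : ∀ {i i' c} → toℕ i < toℕ i' → OnHᵢ i c → OnHᵢ i' c → ⊥
  OnH-separated {i} i<i' on on'
    with b≤c , c≤a ← OnH-between (<⇒≤ (b<a i)) on (≤-<-trans (OnH-row on') (top-decreasing i<i'))
       | OnH-outside on'
  ... | inj₁ a'≤c = <⇒≱ (a-increasing i<i') (≤-trans a'≤c c≤a)
  ... | inj₂ c≤b' = <⇒≱ (b-decreasing i<i') (≤-trans b≤c c≤b')

  OnH-disjoint : ∀ {i i' c} → OnHᵢ i c → OnHᵢ i' c → i ≡ i'
  OnH-disjoint {i} {i'} on on' with <-cmp (toℕ i) (toℕ i')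
  ... | tri< i<i' _ _ = ⊥-elim (OnH-separated i<i' on on')
  ... | tri≈ _ i≡i' _ = toℕ-injective i≡i'
  ... | tri> _ _ i'<i = ⊥-elim (OnH-separated i'<i on' on)

  OnH⇒Inside : ∀ {i c} → OnHᵢ i c → Inside n c
  OnH⇒Inside {i} (on-ascent r≤top)  = ≤-<-trans r≤top (top<n i) , <-trans (a<N' i) (n<1+n N')
  OnH⇒Inside {i} (on-descent r≤top) = ≤-<-trans r≤top (top<n i) , <-trans (b<N' i) (n<1+n N')
  OnH⇒Inside {i} (on-right _ p<N)   = top<n i , p<N
  OnH⇒Inside {i} (on-left p<b)      = top<n i , <-trans p<b (<-trans (b<N' i) (n<1+n N'))

  ∈ascent : ∀ {i c} → c ∈ ascent i → ∃[ r ] (r ≤ top i × c ≡ (r , a i))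
  ∈ascent {i} c∈ with r , r<t+1 , refl ← ∈-applyUpTo⁻ (λ r → (r , a i)) c∈ =
    r , ≤-pred r<t+1 , refl

  ∈toLastColumn : ∀ {i c} → c ∈ toLastColumn i → ∃[ p ] (a i < p × p < N × c ≡ (top i , p))
  ∈toLastColumn {i} c∈ with t , t<b , refl ← ∈-applyUpTo⁻ (λ t → (top i , t + suc (a i))) c∈ =
    _ , m≤n+m (suc (a i)) t ,
    s≤s (subst (t + suc (a i) ≤_) (a+b≡N' i) (+-monoˡ-≤ (suc (a i)) (≤-pred t<b))) , refl

  ∈fromFirstColumn : ∀ {i c} → c ∈ fromFirstColumn i → ∃[ p ] (p < b i × c ≡ (top i , p))
  ∈fromFirstColumn {i} c∈ with p , p<b , refl ← ∈-applyUpTo⁻ (λ p → (top i , p)) c∈ =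
    p , p<b , refl

  ∈descent : ∀ {i c} → c ∈ descent i → ∃[ r ] (r ≤ top i × c ≡ (r , b i))
  ∈descent {i} c∈ with r , r<t+1 , refl ← ∈-applyDownFrom⁻ (λ r → (r , b i)) c∈ =
    r , ≤-pred r<t+1 , refl

  ∈H⇒OnH : ∀ i {c} → c ∈ H i → OnHᵢ i c
  ∈H⇒OnH i c∈ with ∈-++⁻ (ascent i) c∈
  ... | inj₁ c∈A with _ , r≤top , refl ← ∈ascent {i} c∈A = on-ascent r≤top
  ... | inj₂ c∈rest with ∈-++⁻ (toLastColumn i) c∈rest
  ...   | inj₁ c∈T with _ , a<p , p<N , refl ← ∈toLastColumn {i} c∈T = on-right a<p p<N
  ...   | inj₂ c∈rest′ with ∈-++⁻ (fromFirstColumn i) c∈rest′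
  ...     | inj₁ c∈F with _ , p<b , refl ← ∈fromFirstColumn {i} c∈F = on-left p<b
  ...     | inj₂ c∈D with _ , r≤top , refl ← ∈descent {i} c∈D = on-descent r≤top

  H-unique : ∀ i → Unique (H i)
  H-unique i =
    Uniqueₚ.++⁺ (Uniqueₚ.applyUpTo⁺₁ (λ r → (r , a i)) _ (λ r<r' _ → <⇒≢ r<r' ∘ cong row))
      (Uniqueₚ.++⁺ (Uniqueₚ.applyUpTo⁺₁ (λ t → (top i , t + suc (a i))) _
                                      (λ t<t' _ → <⇒≢ t<t' ∘ +-cancelʳ-≡ _ _ _ ∘ cong col))
        (Uniqueₚ.++⁺ (Uniqueₚ.applyUpTo⁺₁ (λ p → (top i , p)) _ (λ p<p' _ → <⇒≢ p<p' ∘ cong col))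
                     (Uniqueₚ.applyDownFrom⁺₁ (λ r → (r , b i)) _
                                              (λ r'<r _ → <⇒≢ r'<r ∘ sym ∘ cong row))
                     left-vs-descent)
        right-vs-rest)
      ascent-vs-rest
    where
    left-or-descent-col : ∀ {c} → c ∈ fromFirstColumn i ++ descent i → col c ≤ b i
    left-or-descent-col c∈ with ∈-++⁻ (fromFirstColumn i) c∈
    ... | inj₁ c∈F with _ , p<b , refl ← ∈fromFirstColumn {i} c∈F = <⇒≤ p<b
    ... | inj₂ c∈D with _ , _ , refl ← ∈descent {i} c∈D = ≤-refl
    left-vs-descent : Disjoint (fromFirstColumn i) (descent i)
    left-vs-descent (c∈F , c∈D)
      with _ , p<b , refl ← ∈fromFirstColumn {i} c∈F | _ , _ , e ← ∈descent {i} c∈D = <⇒≢ p<b (cong col e)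
    right-vs-rest : Disjoint (toLastColumn i) (fromFirstColumn i ++ descent i)
    right-vs-rest (c∈T , c∈rest) with _ , a<p , _ , refl ← ∈toLastColumn {i} c∈T =
      <⇒≱ (<-trans (b<a i) a<p) (left-or-descent-col c∈rest)
    ascent-vs-rest : Disjoint (ascent i) (toLastColumn i ++ fromFirstColumn i ++ descent i)
    ascent-vs-rest (c∈A , c∈rest)
      with _ , _ , refl ← ∈ascent {i} c∈A | ∈-++⁻ (toLastColumn i) c∈rest
    ... | inj₁ c∈T with _ , a<p , _ , e ← ∈toLastColumn {i} c∈T = <⇒≢ a<p (cong col e)
    ... | inj₂ c∈rest′ = <⇒≱ (b<a i) (left-or-descent-col c∈rest′)

  ∈W : ∀ {j c} → c ∈ W j → ∃[ p ] (p < N × c ≡ (toℕ j , p))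
  ∈W {j} c∈ with ∈-++⁻ (leftHalf j) c∈
  ... | inj₁ c∈L with p , p<n , refl ← ∈-applyUpTo⁻ (λ p → (toℕ j , p)) c∈L =
    p , <-≤-trans p<n (m≤m+n n n) , refl
  ... | inj₂ c∈R with t , t<n , refl ← ∈-applyUpTo⁻ (λ t → (toℕ j , t + n)) c∈R =
    t + n , +-monoˡ-< n t<n , refl

  W-unique : ∀ j → Unique (W j)
  W-unique j =
    Uniqueₚ.++⁺ (Uniqueₚ.applyUpTo⁺₁ (λ p → (toℕ j , p)) _ (λ p<p' _ → <⇒≢ p<p' ∘ cong col))
                (Uniqueₚ.applyUpTo⁺₁ (λ t → (toℕ j , t + n)) _
                                     (λ t<t' _ → <⇒≢ t<t' ∘ +-cancelʳ-≡ _ _ _ ∘ cong col))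
                left-vs-right
    where
    left-vs-right : Disjoint (leftHalf j) (rightHalf j)
    left-vs-right (c∈L , c∈R) with _ , p<n , refl ← ∈-applyUpTo⁻ (λ p → (toℕ j , p)) c∈L
                                 | t , _ , e ← ∈-applyUpTo⁻ (λ t → (toℕ j , t + n)) c∈R =
      <⇒≱ p<n (subst (n ≤_) (sym (cong col e)) (m≤n+m n t))

  ∈W⇒Inside : ∀ {j c} → c ∈ W j → Inside n c
  ∈W⇒Inside {j} c∈ with _ , p<N , refl ← ∈W {j} c∈ = <-≤-trans (toℕ<n j) (m≤m+n k k) , p<N

  a-even : ∀ i → a i ≡ (toℕ i + k) + (toℕ i + k)
  a-even i = identity (toℕ i) k
    where
    identity : ∀ u k → (u + u) + (k + k) ≡ (u + k) + (u + k)
    identity = solve-∀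

  HArc⇒Arc : ∀ {i c c'} → HArcᵢ i c c' → Arc (vx c) (vx c')
  HArc⇒Arc {i} (up {r} r<top) =
    subst (λ p → Arc (vx (r , p)) (vx (suc r , p))) (sym (a-even i))
      (up-arc {q = toℕ i + k} (≤-<-trans r<top (top<n i)) (subst (_< N) (a-even i) (m<n⇒m<1+n (a<N' i))))
  HArc⇒Arc (right-from-a _ _) = right-arc _ _
  HArc⇒Arc wrap               = wrap-arc _
  HArc⇒Arc (right-to-b _)     = right-arc _ _
  HArc⇒Arc {i} (down r<top)   = down-arc {q = w i} (≤-<-trans r<top (top<n i)) (m<n⇒m<1+n (b<N' i))

  RightArc⇒Arc : ∀ {c c'} → RightArc c c' → Arc (vx c) (vx c')
  RightArc⇒Arc right = right-arc _ _

  coordinate-linkage : ∀ {R : Fin k → Coord → Coord → Set} (L : Fin k → List Coord) →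
            (∀ {i c c'} → R i c c' → Arc (vx c) (vx c')) → (∀ i → IsPath (Inside n) (R i) (L i)) →
            (∀ {i i' c} → c ∈ L i → c ∈ L i' → i ≡ i') → IsLinkage Vertex Arc k (λ i → map vx (L i))
  coordinate-linkage L R⇒Arc paths disjoint = path , separated
    where
    inside : ∀ i → All (Inside n) (L i)
    inside i = proj₂ (proj₂ (proj₂ (paths i)))
    nonempty-map : ∀ {l} → l ≢ [] → map vx l ≢ []
    nonempty-map {[]}    l≢[] = contradiction refl l≢[]
    nonempty-map {_ ∷ _} _    = λ ()
    path : ∀ i → IsPath Vertex Arc (map vx (L i))
    path i with nonempty , unique , linked , _ ← paths i =
      nonempty-map nonempty , unique-map vx vx-injective (inside i) unique ,
      Linkedₚ.map⁺ (Linked.map R⇒Arc linked) , Allₚ.map⁺ (All.universal (λ c → vx-vertex c) (L i))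
    separated : ∀ i i' → i ≢ i' → Defs.Disjoint (map vx (L i)) (map vx (L i'))
    separated i i' i≢i' v v∈ v∈'
      with c , c∈ , refl ← ∈-map⁻ vx v∈ | c' , c'∈ , e ← ∈-map⁻ vx v∈' =
      i≢i' (disjoint c∈ (subst (_∈ L i') (sym (vx-injective (All.lookup (inside i) c∈)
                                                              (All.lookup (inside i') c'∈) e)) c'∈))

  W-disjoint : ∀ {j j' c} → c ∈ W j → c ∈ W j' → j ≡ j'
  W-disjoint {j} {j'} c∈ c∈' with _ , _ , refl ← ∈W {j} c∈ | _ , _ , e ← ∈W {j'} c∈' =
    toℕ-injective (cong row e)

  Hᵛ Wᵛ : Fin k → List V
  Hᵛ i = map vx (H i)
  Wᵛ j = map vx (W j)

  H-inside : ∀ i → All (Inside n) (H i)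
  H-inside i = All.tabulate (λ c∈ → OnH⇒Inside {i} (∈H⇒OnH i c∈))

  W-inside : ∀ j → All (Inside n) (W j)
  W-inside j = All.tabulate (∈W⇒Inside {j})

  H-linkage : IsLinkage Vertex Arc k Hᵛ
  H-linkage = coordinate-linkage H (λ {i} → HArc⇒Arc {i})
    (λ i → (λ ()) , H-unique i , H-linked i , H-inside i)
    (λ {i} {i'} c∈ c∈' → OnH-disjoint (∈H⇒OnH i c∈) (∈H⇒OnH i' c∈'))

  W-linkage : IsLinkage Vertex Arc k Wᵛ
  W-linkage = coordinate-linkage W (λ {j} → RightArc⇒Arc)
    (λ j → (λ ()) , W-unique j , W-linked j , W-inside j)
    W-disjoint

  j≤top : ∀ (i j : Fin k) → toℕ j ≤ top i
  j≤top i j = <⇒≤ (<-≤-trans (toℕ<n j) (k≤top i))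

  ∈ascent⁺ : ∀ {i r} → r ≤ top i → (r , a i) ∈ ascent i
  ∈ascent⁺ {i} r≤top = ∈-applyUpTo⁺ (λ r → (r , a i)) (s≤s r≤top)

  a∈rightHalf : ∀ i j → (toℕ j , a i) ∈ rightHalf j
  a∈rightHalf i j = ∈-applyUpTo⁺ (λ t → (toℕ j , t + n)) (+-mono-<-≤ (toℕ<n i) (<⇒≤ (toℕ<n i)))

  web : IsWeb Hᵛ Wᵛ
  web i j = vx (toℕ j , a i) , ∈-map⁺ vx (∈-++⁺ˡ (∈ascent⁺ {i} (j≤top i j))) ,
            ∈-map⁺ vx (∈-++⁺ʳ (leftHalf j) (a∈rightHalf i j))

  H-prefix : Fin k → List Coord
  H-prefix i = ascent i ++ toLastColumn i ++ fromFirstColumn i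

  H-split : ∀ i → Hᵛ i ≡ map vx (H-prefix i) ++ map vx (descent i)
  H-split i = trans (cong (map vx) (trans (cong (ascent i ++_) (sym (++-assoc (toLastColumn i) _ _)))
                                          (sym (++-assoc (ascent i) _ _))))
                    (map-++ vx (H-prefix i) (descent i))

  rightHalf-misses-descent : ∀ {i j v} → v ∈ map vx (rightHalf j) → v ∈ map vx (descent i) → ⊥
  rightHalf-misses-descent {i} {j} v∈R v∈D
    with ∈-map⁻ vx v∈R | ∈-map⁻ vx v∈D
  ... | c , c∈ , refl | c' , c'∈ , e
    with ∈-applyUpTo⁻ (λ t → (toℕ j , t + n)) c∈ | ∈descent {i} c'∈
  ... | t , _ , refl | _ , r≤top , refl =
    <⇒≱ (b<n i) (subst (n ≤_) (cong col (vx-injective (∈W⇒Inside {j} (∈-++⁺ʳ (leftHalf j) c∈))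
                                                       (OnH⇒Inside {i} (on-descent r≤top)) e))
                       (m≤n+m n t))

  two-horizontal : TwoHorizontal Hᵛ Wᵛ
  two-horizontal = H¹ , H² , W¹ , W² ,
    (λ i → map vx (H-prefix i) , _ , _ , H-split i , refl , refl) ,
    (λ j → map vx (leftHalf j) , _ , _ , map-++ vx (leftHalf j) (rightHalf j) , refl , refl) ,
    λ i j → W¹∩H⊆H¹∪H² i j , W¹-meets-H² i j , W²∩H⊆H¹ i j , W²-meets-H¹ i j
    where
    H¹ H² W¹ W² : Fin k → List V
    H¹ i  = map vx (H-prefix i) ++ [ vx (top i , b i) ]
    H² i  = map vx (descent i)
    W¹ j  = map vx (leftHalf j) ++ [ vx (toℕ j , n) ]
    W² j  = map vx (rightHalf j)
    H⊆H¹∪H² : ∀ {i v} → v ∈ Hᵛ i → v ∈ H¹ i ⊎ v ∈ H² i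
    H⊆H¹∪H² {i} {v} v∈ with ∈-++⁻ (map vx (H-prefix i)) (subst (v ∈_) (H-split i) v∈)
    ... | inj₁ v∈P = inj₁ (∈-++⁺ˡ v∈P)
    ... | inj₂ v∈D = inj₂ v∈D
    W¹∩H⊆H¹∪H² : ∀ i j v → v ∈ W¹ j → v ∈ Hᵛ i → v ∈ H¹ i ⊎ v ∈ H² i
    W¹∩H⊆H¹∪H² i j v _ = H⊆H¹∪H² {i}
    W¹-meets-H² : ∀ i j → Meets (W¹ j) (H² i)
    W¹-meets-H² i j = vx (toℕ j , b i) ,
                      ∈-++⁺ˡ (∈-map⁺ vx (∈-applyUpTo⁺ (λ p → (toℕ j , p)) (b<n i))) ,
                      ∈-map⁺ vx (∈-applyDownFrom⁺ (λ r → (r , b i)) (s≤s (j≤top i j)))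
    W²∩H⊆H¹ : ∀ i j v → v ∈ W² j → v ∈ Hᵛ i → v ∈ H¹ i
    W²∩H⊆H¹ i j v v∈W² v∈H with H⊆H¹∪H² {i} v∈H
    ... | inj₁ v∈H¹ = v∈H¹
    ... | inj₂ v∈H² = ⊥-elim (rightHalf-misses-descent {i} {j} v∈W² v∈H²)
    W²-meets-H¹ : ∀ i j → Meets (W² j) (H¹ i)
    W²-meets-H¹ i j = vx (toℕ j , a i) , ∈-map⁺ vx (a∈rightHalf i j) ,
                      ∈-++⁺ˡ (∈-map⁺ vx (∈-++⁺ˡ (∈ascent⁺ {i} (j≤top i j))))

  -- Minimality

  HArc-crossing : ∀ {a b top x y} → n ≤ a → b < n → HArc a b top x y → n ≤ col x → col y < n →
                  x ≡ (top , N') × y ≡ (top , 0)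
  HArc-crossing n≤a _   (up _)             _   y<n = ⊥-elim (<⇒≱ y<n n≤a)
  HArc-crossing _   _   (right-from-a _ _) n≤x y<n = ⊥-elim (<⇒≱ y<n (m≤n⇒m≤1+n n≤x))
  HArc-crossing _   _   wrap               _   _   = refl , refl
  HArc-crossing _   _   (right-to-b _)     n≤x y<n = ⊥-elim (<⇒≱ y<n (m≤n⇒m≤1+n n≤x))
  HArc-crossing _   b<n (down _)           n≤x _   = ⊥-elim (<⇒≱ b<n n≤x)

  HArc-rising : ∀ {a b top j x y} → HArc a b top x y → row x ≤ j → j < row y →
                x ≡ (j , a) × y ≡ (suc j , a)
  HArc-rising (up _) r≤j j<r+1 with refl ← ≤-antisym r≤j (≤-pred j<r+1) = refl , refl
  HArc-rising (right-from-a _ _) t≤j j<t = ⊥-elim (<⇒≱ j<t t≤j)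
  HArc-rising wrap               t≤j j<t = ⊥-elim (<⇒≱ j<t t≤j)
  HArc-rising (right-to-b _)     t≤j j<t = ⊥-elim (<⇒≱ j<t t≤j)
  HArc-rising (down _)           r+1≤j j<r = ⊥-elim (<⇒≱ j<r (≤-trans (n≤1+n _) r+1≤j))

  HArc-falling : ∀ {a b top j x y} → HArc a b top x y → j < row x → row y ≤ j →
                 x ≡ (suc j , b) × y ≡ (j , b)
  HArc-falling (down _) j<r+1 r≤j with refl ← ≤-antisym r≤j (≤-pred j<r+1) = refl , refl
  HArc-falling (up _)             j<r r+1≤j = ⊥-elim (<⇒≱ j<r (≤-trans (n≤1+n _) r+1≤j))
  HArc-falling (right-from-a _ _) j<t t≤j = ⊥-elim (<⇒≱ j<t t≤j)
  HArc-falling wrap               j<t t≤j = ⊥-elim (<⇒≱ j<t t≤j)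
  HArc-falling (right-to-b _)     j<t t≤j = ⊥-elim (<⇒≱ j<t t≤j)

  HArc-into-right : ∀ {a b top p x} → a ≤ p → HArc a b top x (top , suc p) → x ≡ (top , p)
  HArc-into-right p+1≤p (up _)       = ⊥-elim (<-irrefl refl p+1≤p)
  HArc-into-right _ (right-from-a _ _) = refl
  HArc-into-right _ (right-to-b _)     = refl
  HArc-into-right _ (down r<r)         = ⊥-elim (<-irrefl refl r<r)

  HArc-into-ascent : ∀ {a b top r x} → b < a → 0 < a → HArc a b top x (suc r , a) → x ≡ (r , a)
  HArc-into-ascent _   _   (up _)                  = refl
  HArc-into-ascent _   _   (right-from-a p+1≤p _)  = ⊥-elim (<-irrefl refl p+1≤p)
  HArc-into-ascent _   0<0 wrap                    = ⊥-elim (<-irrefl refl 0<0)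
  HArc-into-ascent b<a _   (right-to-b p<b)        = ⊥-elim (<⇒≱ p<b (≤-pred b<a))
  HArc-into-ascent b<b _   (down _)                = ⊥-elim (<-irrefl refl b<b)

  HArc-out-of-left : ∀ {a b top p y} → b < a → b < N' → p < b → HArc a b top (top , p) y →
                     y ≡ (top , suc p)
  HArc-out-of-left b<a _    a<b  (up _)             = ⊥-elim (<-asym a<b b<a)
  HArc-out-of-left _   _    _    (right-from-a _ _) = refl
  HArc-out-of-left _   b<N' N'<b wrap               = ⊥-elim (<-asym N'<b b<N')
  HArc-out-of-left _   _    _    (right-to-b _)     = refl
  HArc-out-of-left _   _    b<b  (down _)           = ⊥-elim (<-irrefl refl b<b)

  HArc-out-of-descent : ∀ {a b top r y} → b < a → b < N' → HArc a b top (suc r , b) y → y ≡ (r , b)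
  HArc-out-of-descent b<b _ (up _)                 = ⊥-elim (<-irrefl refl b<b)
  HArc-out-of-descent b<a _ (right-from-a a≤b _)   = ⊥-elim (<⇒≱ b<a a≤b)
  HArc-out-of-descent _ N'<N' wrap                 = ⊥-elim (<-irrefl refl N'<N')
  HArc-out-of-descent _ _ (right-to-b b<b)         = ⊥-elim (<-irrefl refl b<b)
  HArc-out-of-descent _ _ (down _)                 = refl

  RightArc-row : ∀ {x y} → RightArc x y → row x ≡ row y
  RightArc-row right = refl

  RightArc-col : ∀ {x y} → RightArc x y → col y ≡ suc (col x)
  RightArc-col right = refl

  HWArc : Coord → Coord → Set
  HWArc x y = (∃[ i ] ArcOf (H i) x y) ⊎ (∃[ j ] ArcOf (W j) x y)

  HWArc-crossing : ∀ {x y} → HWArc x y → n ≤ col x → col y < n →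
                   ∃[ i ] (x ≡ (top i , N') × y ≡ (top i , 0))
  HWArc-crossing (inj₁ (i , arc)) n≤x y<n =
    i , HArc-crossing (n≤a i) (b<n i) (arcOf-linked (H-linked i) arc) n≤x y<n
  HWArc-crossing (inj₂ (j , arc)) n≤x y<n =
    ⊥-elim (<⇒≱ y<n (subst (n ≤_) (sym (RightArc-col (arcOf-linked (W-linked j) arc))) (m≤n⇒m≤1+n n≤x)))

  HWArc-rising : ∀ {j x y} → HWArc x y → row x ≤ j → j < row y →
                 ∃[ i ] (x ≡ (j , a i) × y ≡ (suc j , a i))
  HWArc-rising (inj₁ (i , arc)) x≤j j<y = i , HArc-rising (arcOf-linked (H-linked i) arc) x≤j j<y
  HWArc-rising (inj₂ (j , arc)) x≤j j<y =
    ⊥-elim (<⇒≱ j<y (subst (_≤ _) (RightArc-row (arcOf-linked (W-linked j) arc)) x≤j))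

  HWArc-falling : ∀ {j x y} → HWArc x y → j < row x → row y ≤ j →
                  ∃[ i ] (x ≡ (suc j , b i) × y ≡ (j , b i))
  HWArc-falling (inj₁ (i , arc)) j<x y≤j = i , HArc-falling (arcOf-linked (H-linked i) arc) j<x y≤j
  HWArc-falling (inj₂ (j , arc)) j<x y≤j =
    ⊥-elim (<⇒≱ j<x (subst (_≤ _) (sym (RightArc-row (arcOf-linked (W-linked j) arc))) y≤j))

  HWArc-into-H : ∀ {i x y} → HWArc x y → OnHᵢ i y → k ≤ row y → HArcᵢ i x y
  HWArc-into-H {i} (inj₁ (i' , arc)) onH _
    with refl ← OnH-disjoint {i'} {i} (∈H⇒OnH i' (proj₂ (arcOf⇒∈ arc))) onH = arcOf-linked (H-linked i') arc
  HWArc-into-H (inj₂ (j , arc)) _ k≤y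
    with _ , _ , refl ← ∈W {j} (proj₂ (arcOf⇒∈ arc)) = ⊥-elim (<⇒≱ (toℕ<n j) k≤y)

  HWArc-out-of-H : ∀ {i x y} → HWArc x y → OnHᵢ i x → k ≤ row x → HArcᵢ i x y
  HWArc-out-of-H {i} (inj₁ (i' , arc)) onH _
    with refl ← OnH-disjoint {i'} {i} (∈H⇒OnH i' (proj₁ (arcOf⇒∈ arc))) onH = arcOf-linked (H-linked i') arc
  HWArc-out-of-H (inj₂ (j , arc)) _ k≤x
    with _ , _ , refl ← ∈W {j} (proj₁ (arcOf⇒∈ arc)) = ⊥-elim (<⇒≱ (toℕ<n j) k≤x)

  record HWLinkage (L : Fin k → List Coord) : Set where
    field
      arcs     : ∀ m {x y} → ArcOf (L m) x y → HWArc x y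
      disjoint : ∀ {m m' c} → c ∈ L m → c ∈ L m' → m ≡ m'
      starts   : ∀ m → ∃[ i ] IsStart (0 , a i) (L m)
      ends     : ∀ m → ∃[ i ] IsEnd (0 , b i) (L m)

  module Rerouting {L : Fin k → List Coord} (ℒ : HWLinkage L) where
    open HWLinkage ℒ

    forced-in : ∀ {m x y} → y ∈ L m → 0 < row y → (∀ {x'} → HWArc x' y → x' ≡ x) →
                ArcOf (L m) x y
    forced-in {m} {y = y} y∈ 0<y unique with i , start ← starts m
      with z , arc ← predecessor start y∈ (λ y≡start → <-irrefl (sym (cong row y≡start)) 0<y) =
      subst (λ z → ArcOf (L m) z y) (unique (arcs m arc)) arc

    forced-out : ∀ {m x y} → x ∈ L m → 0 < row x → (∀ {y'} → HWArc x y' → y' ≡ y) →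
                 ArcOf (L m) x y
    forced-out {m} {x} x∈ 0<x unique with i , end ← ends m
      with z , arc ← successor end x∈ (λ x≡end → <-irrefl (sym (cong row x≡end)) 0<x) =
      subst (ArcOf (L m) x) (unique (arcs m arc)) arc

    every-cut-arc-used : (x y : Fin k → Coord) → (∀ m → ∃[ i ] ArcOf (L m) (x i) (y i)) →
                         ∀ i → ∃[ m ] ArcOf (L m) (x i) (y i)
    every-cut-arc-used x y cover =
      total-injective⇒surjective cover
        (λ arc arc' → disjoint (proj₁ (arcOf⇒∈ arc)) (proj₁ (arcOf⇒∈ arc')))

    crossing : ∀ m → ∃[ i ] ArcOf (L m) (top i , N') (top i , 0)
    crossing m with i , start ← starts m | i' , end ← ends m
      with _ , _ , arc , n≤x , y≱n ← exit-arc (λ c → n ≤? col c) start (n≤a i) (isEnd⇒∈ end)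
                                               (<⇒≱ (b<n i'))
      with i'' , refl , refl ← HWArc-crossing (arcs m arc) n≤x (≰⇒> y≱n) = i'' , arc

    rising : ∀ {j} → j < k → ∀ m → ∃[ i ] ArcOf (L m) (j , a i) (suc j , a i)
    rising {j} j<k m with i , start ← starts m | i' , cross ← crossing m
      with _ , _ , arc , x≤j , y≰j ← exit-arc (λ c → row c ≤? j) start z≤n (proj₁ (arcOf⇒∈ cross))
                                               (<⇒≱ (<-≤-trans j<k (k≤top i')))
      with i'' , refl , refl ← HWArc-rising (arcs m arc) x≤j (≰⇒> y≰j) = i'' , arc

    falling : ∀ {j} → j < k → ∀ m → ∃[ i ] ArcOf (L m) (suc j , b i) (j , b i)
    falling {j} j<k m with i , end ← ends m | i' , cross ← crossing m
      with _ , _ , arc , j<x , j≮y ← exit-arc-before-end (λ c → j <? row c) end (proj₂ (arcOf⇒∈ cross))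
                                                         (<-≤-trans j<k (k≤top i')) (λ ())
      with i'' , refl , refl ← HWArc-falling (arcs m arc) j<x (≮⇒≥ j≮y) = i'' , arc

    module Along (i : Fin k) where
      wrap-user : ∃[ m ] ArcOf (L m) (top i , N') (top i , 0)
      wrap-user = every-cut-arc-used (λ i → (top i , N')) (λ i → (top i , 0)) crossing i

      m₀ : Fin k
      m₀ = proj₁ wrap-user

      wrap-used : ArcOf (L m₀) (top i , N') (top i , 0)
      wrap-used = proj₂ wrap-user

      forced-into-H : ∀ {x y} → y ∈ L m₀ → OnHᵢ i y → k ≤ row y →
                      (∀ {x'} → HArcᵢ i x' y → x' ≡ x) → ArcOf (L m₀) x y
      forced-into-H y∈ onH k≤y determined =
        forced-in y∈ (<-≤-trans z<s k≤y) (λ arc → determined (HWArc-into-H {i} arc onH k≤y))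

      forced-out-of-H : ∀ {x y} → x ∈ L m₀ → OnHᵢ i x → k ≤ row x →
                        (∀ {y'} → HArcᵢ i x y' → y' ≡ y) → ArcOf (L m₀) x y
      forced-out-of-H x∈ onH k≤x determined =
        forced-out x∈ (<-≤-trans z<s k≤x) (λ arc → determined (HWArc-out-of-H {i} arc onH k≤x))

      right-from-a-used : ∀ {p} → a i ≤ p → p < N' → (top i , suc p) ∈ L m₀ →
                          ArcOf (L m₀) (top i , p) (top i , suc p)
      right-from-a-used a≤p p<N' y∈ =
        forced-into-H y∈ (on-right (s≤s a≤p) (s≤s p<N')) (k≤top i) (HArc-into-right a≤p)

      on-right-part : ∀ {p} → p ≤ N' → a i ≤ p → (top i , p) ∈ L m₀
      on-right-part = downward-induction (λ _ → proj₁ (arcOf⇒∈ wrap-used))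
        (λ p<N' next a≤p → proj₁ (arcOf⇒∈ (right-from-a-used a≤p p<N' (next (m≤n⇒m≤1+n a≤p)))))

      up-used : ∀ {r} → k ≤ r → r < top i → (suc r , a i) ∈ L m₀ →
                ArcOf (L m₀) (r , a i) (suc r , a i)
      up-used k≤r r<top y∈ = forced-into-H y∈ (on-ascent r<top) (m≤n⇒m≤1+n k≤r)
                                           (HArc-into-ascent (b<a i) (<-≤-trans z<s (n≤a i)))

      on-ascent-part : ∀ {r} → r ≤ top i → k ≤ r → (r , a i) ∈ L m₀
      on-ascent-part = downward-induction (λ _ → on-right-part (<⇒≤ (a<N' i)) ≤-refl)
        (λ r<top next k≤r → proj₁ (arcOf⇒∈ (up-used k≤r r<top (next (m≤n⇒m≤1+n k≤r)))))

      right-to-b-used : ∀ {p} → p < b i → (top i , p) ∈ L m₀ → ArcOf (L m₀) (top i , p) (top i , suc p)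
      right-to-b-used p<b x∈ =
        forced-out-of-H x∈ (on-left p<b) (k≤top i) (HArc-out-of-left (b<a i) (b<N' i) p<b)

      on-left-part : ∀ {p} → p ≤ b i → (top i , p) ∈ L m₀
      on-left-part {zero}  _     = proj₂ (arcOf⇒∈ wrap-used)
      on-left-part {suc p} p<b = proj₂ (arcOf⇒∈ (right-to-b-used p<b (on-left-part (<⇒≤ p<b))))

      down-used : ∀ {r} → k ≤ r → r < top i → (suc r , b i) ∈ L m₀ →
                  ArcOf (L m₀) (suc r , b i) (r , b i)
      down-used k≤r r<top x∈ =
        forced-out-of-H x∈ (on-descent r<top) (m≤n⇒m≤1+n k≤r) (HArc-out-of-descent (b<a i) (b<N' i))

      on-descent-part : ∀ {r} → r ≤ top i → k ≤ r → (r , b i) ∈ L m₀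
      on-descent-part = downward-induction (λ _ → on-left-part ≤-refl)
        (λ r<top next k≤r → proj₂ (arcOf⇒∈ (down-used k≤r r<top (next (m≤n⇒m≤1+n k≤r)))))

      H-arc-used : ∀ {x y} → HArcᵢ i x y → ∃[ m ] ArcOf (L m) x y
      H-arc-used (up {r} r<top) with r <? k
      ... | yes r<k = every-cut-arc-used (λ i → (r , a i)) (λ i → (suc r , a i)) (rising r<k) i
      ... | no r≮k  = m₀ , up-used (≮⇒≥ r≮k) r<top (on-ascent-part r<top (m≤n⇒m≤1+n (≮⇒≥ r≮k)))
      H-arc-used (right-from-a a≤p p<N') =
        m₀ , right-from-a-used a≤p p<N' (on-right-part p<N' (m≤n⇒m≤1+n a≤p))
      H-arc-used wrap                    = m₀ , wrap-used
      H-arc-used (right-to-b p<b)        = m₀ , right-to-b-used p<b (on-left-part (<⇒≤ p<b))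
      H-arc-used (down {r} r<top) with r <? k
      ... | yes r<k = every-cut-arc-used (λ i → (suc r , b i)) (λ i → (r , b i)) (falling r<k) i
      ... | no r≮k  = m₀ , down-used (≮⇒≥ r≮k) r<top (on-descent-part r<top (m≤n⇒m≤1+n (≮⇒≥ r≮k)))

  every-H-arc-used : ∀ {L} → HWLinkage L → ∀ i {x y} → HArcᵢ i x y → ∃[ m ] ArcOf (L m) x y
  every-H-arc-used ℒ = Rerouting.Along.H-arc-used ℒ

  H-end : ∀ i → IsEnd (0 , b i) (H i)
  H-end i = isEnd-++ (ascent i) (isEnd-++ (toLastColumn i) (isEnd-++ (fromFirstColumn i) descent-end))
    where
    descent-end : IsEnd (0 , b i) (descent i)
    descent-end = applyDownFrom (λ r → (suc r , b i)) (top i) ,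
                  sym (applyDownFrom-∷ʳ (λ r → (r , b i)) (top i))

  HWVertexᵛ : V → Set
  HWVertexᵛ v = LVertex Hᵛ v ⊎ LVertex Wᵛ v

  HWArcᵛ-avoiding : V → V → V → V → Set
  HWArcᵛ-avoiding ea eb u v = (LArc Hᵛ u v ⊎ LArc Wᵛ u v) × ¬ (u ≡ ea × v ≡ eb)

  lift-vertex : ∀ {v} → HWVertexᵛ v → ∃[ c ] (Inside n c × vx c ≡ v)
  lift-vertex (inj₁ (i , v∈)) with c , c∈ , refl ← ∈-map⁻ vx v∈ = c , All.lookup (H-inside i) c∈ , refl
  lift-vertex (inj₂ (j , v∈)) with c , c∈ , refl ← ∈-map⁻ vx v∈ = c , All.lookup (W-inside j) c∈ , refl

  lift-arc : ∀ {x y} → Inside n x → Inside n y → LArc Hᵛ (vx x) (vx y) ⊎ LArc Wᵛ (vx x) (vx y) →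
             HWArc x y
  lift-arc x-in y-in (inj₁ (i , arc)) =
    inj₁ (i , injective-arcOf-map⁻ vx vx-injective (H-inside i) x-in y-in arc)
  lift-arc x-in y-in (inj₂ (j , arc)) =
    inj₂ (j , injective-arcOf-map⁻ vx vx-injective (W-inside j) x-in y-in arc)

  module Lifting {ea eb : V} (Q : Fin k → List V)
    (Q-linkage : IsLinkage HWVertexᵛ (HWArcᵛ-avoiding ea eb) k Q)
    (Q-starts : ∀ m → ∃[ v ] (IsStart v (Q m) × Start Hᵛ v))
    (Q-ends : ∀ m → ∃[ v ] (IsEnd v (Q m) × End Hᵛ v)) where

    Q-vertices : ∀ m → All HWVertexᵛ (Q m)
    Q-vertices m = proj₂ (proj₂ (proj₂ (proj₁ Q-linkage m)))

    Q-linked : ∀ m → Linked (HWArcᵛ-avoiding ea eb) (Q m)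
    Q-linked m = proj₁ (proj₂ (proj₂ (proj₁ Q-linkage m)))

    lifted : ∀ m → ∃[ cs ] (All (Inside n) cs × map vx cs ≡ Q m)
    lifted m = map-preimage vx (All.map lift-vertex (Q-vertices m))

    L : Fin k → List Coord
    L m = proj₁ (lifted m)

    L-inside : ∀ m → All (Inside n) (L m)
    L-inside m = proj₁ (proj₂ (lifted m))

    L≡Q : ∀ m → map vx (L m) ≡ Q m
    L≡Q m = proj₂ (proj₂ (lifted m))

    ∈Q : ∀ m {c} → c ∈ L m → vx c ∈ Q m
    ∈Q m {c} c∈ = subst (vx c ∈_) (L≡Q m) (∈-map⁺ vx c∈)

    Q-arc : ∀ m {x y} → ArcOf (L m) x y → HWArcᵛ-avoiding ea eb (vx x) (vx y)
    Q-arc m {x} {y} arc =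
      arcOf-linked (Q-linked m) (subst (λ l → ArcOf l (vx x) (vx y)) (L≡Q m) (arcOf-map⁺ vx arc))

    ℒ : HWLinkage L
    ℒ = record { arcs = arcs ; disjoint = disjoint ; starts = starts ; ends = ends }
      where
      arcs : ∀ m {x y} → ArcOf (L m) x y → HWArc x y
      arcs m arc = lift-arc (All.lookup (L-inside m) (proj₁ (arcOf⇒∈ arc)))
                            (All.lookup (L-inside m) (proj₂ (arcOf⇒∈ arc))) (proj₁ (Q-arc m arc))
      disjoint : ∀ {m m' c} → c ∈ L m → c ∈ L m' → m ≡ m'
      disjoint {m} {m'} {c} c∈ c∈' with m ≟ᶠ m'
      ... | yes m≡m' = m≡m'
      ... | no m≢m'  = ⊥-elim (proj₂ Q-linkage m m' m≢m' (vx c) (∈Q m c∈) (∈Q m' c∈'))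
      starts : ∀ m → ∃[ i ] IsStart (0 , a i) (L m)
      starts m with v , v-start , i , (_ , eH) ← Q-starts m
        with c , c-start , refl ← isStart-map⁻ vx (subst (IsStart v) (sym (L≡Q m)) v-start)
        with refl ← vx-injective (All.lookup (L-inside m) (isStart⇒∈ c-start))
                                 (OnH⇒Inside {i} (on-ascent z≤n)) (sym (proj₁ (∷-injective eH))) =
        i , c-start
      ends : ∀ m → ∃[ i ] IsEnd (0 , b i) (L m)
      ends m with v , v-end , i , v-endH ← Q-ends m
        with c , c-endH , refl ← isEnd-map⁻ vx v-endH
        with refl ← isEnd-unique c-endH (H-end i)
        with c' , c'-end , vc'≡vc ← isEnd-map⁻ vx (subst (IsEnd (vx (0 , b i))) (sym (L≡Q m)) v-end)
        with refl ← vx-injective (All.lookup (L-inside m) (isEnd⇒∈ c'-end))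
                                 (OnH⇒Inside {i} (on-descent z≤n)) vc'≡vc =
        i , c'-end

    removed-arc-not-in-H : ∀ i {x y} → ArcOf (H i) x y → ¬ (vx x ≡ ea × vx y ≡ eb)
    removed-arc-not-in-H i arc with m , used ← every-H-arc-used ℒ i (arcOf-linked (H-linked i) arc) =
      proj₂ (Q-arc m used)

  minimal : MinimalWrt Hᵛ Wᵛ
  minimal ea eb (i , e∈H) _ (Q , Q-linkage , Q-starts , Q-ends)
    with ce , ce' , e-arc , refl , refl ← arcOf-map⁻ vx e∈H =
    Lifting.removed-arc-not-in-H Q Q-linkage Q-starts Q-ends i e-arc (refl , refl)

mainTheorem14 : ∀ (k : ℕ) → 1 ≤ k → (G : Digraph) → (Γ : CylindricalGrid G (k + k)) →
    ∃[ H ] ∃[ W ]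
    ( IsLinkage (GridVertex Γ) (GridArc Γ) k H
    × IsLinkage (GridVertex Γ) (GridArc Γ) k W
    × IsWeb H W
    × TwoHorizontal H W
    × MinimalWrt H W )
mainTheorem14 zero () G Γ
mainTheorem14 (suc K) _ G Γ = Hᵛ , Wᵛ , H-linkage , W-linkage , web , two-horizontal , minimal
  where open Construction K (coordinates Γ)
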